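{- Let $\mathcal{M}=\mathcal{M}(\Sigma,I)$ be a trace monoid acting partially on a finite set $X_0$ of states, with associated total action on $X=X_0\cup\{\bot\}$. Then in the $\mathbb{Z}$-algebra of fibred formal series indexed by $X_0$, the Möbius fibred polynomial $\mu$ is the inverse of the zeta fibred formal series $\zeta$: $\mu\zeta=\zeta\mu=I$.
   Context: Trace monoid: $\Sigma$ finite, $|\Sigma|\ge2$, $I\subseteq\Sigma\times\Sigma$ irreflexive symmetric, $\mathcal{M}$ is $\Sigma^*$ modulo the congruence generated by $ab=ba$ for $(a,b)\in I$; unit $1$, length $|x|$, $x\le y$ iff $y=x\cdot z$. A clique is a trace $a_1\cdots a_k$ ($k\ge0$) of pairwise distinct letters pairwise in $I$; $\mathscr{C}$ is the set of cliques. Two cliques/letters are parallel, $c\parallel c'$, if $c\cdot c'$ is a clique. A partial action consists of nonempty subsets $\Sigma(\alpha)\subseteq\Sigma$ for $\alpha\in X_0$ and maps $\Sigma(\alpha)\to X_0$, $a\mapsto\alpha\cdot a$, such that whenever $a\in\Sigma(\alpha)$ and $a\parallel b$: either $b\in\Sigma(\alpha)$, and then $a\in\Sigma(\alpha\cdot b)$, $b\in\Sigma(\alpha\cdot a)$ and $(\alpha\cdot a)\cdot b=(\alpha\cdot b)\cdot a$; or $b\notin\Sigma(\alpha)$, and then $b\notin\Sigma(\alpha\cdot a)$. The associated total action is the unique right action of $\mathcal{M}$ on $X=X_0\cup\{\bot\}$ with $\alpha\cdot a$ as given for $a\in\Sigma(\alpha)$, $\alpha\cdot a=\bot$ for $a\notin\Sigma(\alpha)$,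 and $\bot\cdot a=\bot$. For $\alpha,\beta\in X_0$, $\mathcal{M}_{\alpha,\beta}=\{x\in\mathcal{M}:\alpha\cdot x=\beta\}$. A fibred formal series is a matrix $F=(F_{\alpha,\beta})_{\alpha,\beta\in X_0}$ of maps $F_{\alpha,\beta}:\mathcal{M}\to\mathbb{Z}$ with $F_{\alpha,\beta}(x)\neq0\Rightarrow x\in\mathcal{M}_{\alpha,\beta}$. Sum and scalar multiplication are termwise; the product is $(FG)_{\alpha,\gamma}(x)=\sum_{\beta\in X_0}\sum_{(y,z)\in\mathcal{M}_{\alpha,\beta}\times\mathcal{M}_{\beta,\gamma}:\,y\cdot z=x}F_{\alpha,\beta}(y)G_{\beta,\gamma}(z)$; the identity is $I_{\alpha,\beta}(x)=\mathbf{1}_{\{\alpha=\beta\}}\mathbf{1}_{\{x=1\}}$. The zeta series is $\zeta_{\alpha,\beta}(x)=\mathbf{1}_{\{x\in\mathcal{M}_{\alpha,\beta}\}}$ and the Möbius fibred polynomial is $\mu_{\alpha,\beta}(x)=(-1)^{|x|}\mathbf{1}_{\{x\in\mathscr{C}\cap\mathcal{M}_{\alpha,\beta}\}}$. -}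

module Defs where

open import Data.Nat using (ℕ; zero; suc)
open import Data.Fin using (Fin)
open import Data.Fin.Properties using () renaming (_≟_ to _≟ᶠ_)
open import Data.Bool using (Bool; true; false; if_then_else_; _∧_) renaming (_≟_ to _≟ᵇ_)
open import Data.Maybe using (Maybe; just; nothing)
open import Data.Maybe.Properties using () renaming (≡-dec to ≡-decᴹ)
open import Data.List using (List; []; _∷_; _++_; map; concatMap; upTo; length; deduplicate; foldr; allFin)
open import Data.List.Relation.Unary.AllPairs using (AllPairs; allPairs?)
open import Data.Integer using (ℤ; _+_; _*_; -_; _^_) renaming (0ℤ to 0ℤ; 1ℤ to 1ℤ)
open import Data.Product using (Σ; ∃; _×_; _,_)
open import Relation.Nullary using (¬_; Dec; yes; no; _×-dec_; ¬?)
open import Relation.Nullary.Decidable using (⌊_⌋)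
open import Relation.Binary using (Rel; Decidable)
open import Relation.Binary.PropositionalEquality using (_≡_; _≢_)
open import Relation.Binary.Construct.Closure.Equivalence using (EqClosure)


-- Alphabet Σ = Fin n, independence relation I given as a Boolean matrix.

Irreflexiveᴵ : ∀ {n} → (Fin n → Fin n → Bool) → Set
Irreflexiveᴵ I = ∀ a → I a a ≡ false

Symmetricᴵ : ∀ {n} → (Fin n → Fin n → Bool) → Set
Symmetricᴵ I = ∀ a b → I a b ≡ I b a

-- The trace monoid M(Σ,I): words modulo the congruence generated by
-- ab = ba for (a,b) ∈ I.

data Swap {n : ℕ} (I : Fin n → Fin n → Bool) : Rel (List (Fin n)) Agda.Primitive.lzero where
  swap : ∀ (p q : List (Fin n)) (a b : Fin n) → I a b ≡ true →
         Swap I (p ++ a ∷ b ∷ q) (p ++ b ∷ a ∷ q)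

_∼[_]_ : ∀ {n} → List (Fin n) → (Fin n → Fin n → Bool) → List (Fin n) → Set
u ∼[ I ] v = EqClosure (Swap I) u v

-- Partial action of M on X₀ = Fin m.  α·a is 'act α a';
-- 'nothing' means a ∉ Σ(α).

record PartialAction {n : ℕ} (I : Fin n → Fin n → Bool) (m : ℕ) : Set where
  field
    act : Fin m → Fin n → Maybe (Fin m)
    nonempty : ∀ α → ∃ λ a → ∃ λ β → act α a ≡ just β
    diamond : ∀ α a b α' β' → I a b ≡ true → a ≢ b →
              act α a ≡ just α' → act α b ≡ just β' →
              ∃ λ γ → act α' b ≡ just γ × act β' a ≡ just γ
    persist : ∀ α a b α' → I a b ≡ true → a ≢ b →
              act α a ≡ just α' → act α b ≡ nothing → act α' b ≡ nothing

-- associated total action on X = X₀ ∪ {⊥} (⊥ = nothing), on words: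
-- ⊥·w = ⊥,  α·[] = α,  α·(a w) = (α·a)·w
actW : ∀ {n m} {I : Fin n → Fin n → Bool} → PartialAction I m →
       Maybe (Fin m) → List (Fin n) → Maybe (Fin m)
actW A nothing _ = nothing
actW A (just α) [] = just α
actW A (just α) (a ∷ w) = actW A (PartialAction.act A α a) w

inM : ∀ {n m} {I : Fin n → Fin n → Bool} → PartialAction I m →
      Fin m → Fin m → List (Fin n) → Bool
inM A α β x = ⌊ ≡-decᴹ _≟ᶠ_ (actW A (just α) x) (just β) ⌋

IsClique : ∀ {n} → (Fin n → Fin n → Bool) → List (Fin n) → Set
IsClique I = AllPairs (λ a b → a ≢ b × I a b ≡ true)

isClique? : ∀ {n} (I : Fin n → Fin n → Bool) → (w : List (Fin n)) → Dec (IsClique I w)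
isClique? I = allPairs? (λ a b → ¬? (a ≟ᶠ b) ×-dec (I a b ≟ᵇ true))

-- Fibred formal series (indexed by X₀ = Fin m), with entries given as
-- functions on words (all entries considered are invariant under ∼).

Series : ℕ → ℕ → Set
Series n m = Fin m → Fin m → List (Fin n) → ℤ

∑ : ∀ {A : Set} → List A → (A → ℤ) → ℤ
∑ xs f = foldr (λ x s → f x + s) 0ℤ xs

allWords : ∀ {n} → ℕ → List (List (Fin n))
allWords zero = [] ∷ []
allWords {n} (suc k) = concatMap (λ a → map (a ∷_) (allWords k)) (allFin n)

traceReps : ∀ {n} {I : Fin n → Fin n → Bool} → Decidable (_∼[ I ]_) →
            ℕ → List (List (Fin n))
traceReps dec L = deduplicate dec (concatMap allWords (upTo (suc L)))

-- product of fibred series: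
-- (FG)_{α,γ}(x) = Σ_β Σ_{(y,z) ∈ M_{α,β} × M_{β,γ}, y·z = x} F_{α,β}(y) G_{β,γ}(z)
-- (y and z range over traces, represented by one word each).
product : ∀ {n m} {I : Fin n → Fin n → Bool} → PartialAction I m →
          Decidable (_∼[ I ]_) → Series n m → Series n m → Series n m
product {n} {m} A dec Fs Gs α γ x =
  ∑ (allFin m) λ β →
  ∑ (traceReps dec (length x)) λ y →
  ∑ (traceReps dec (length x)) λ z →
    if (⌊ dec (y ++ z) x ⌋ ∧ inM A α β y ∧ inM A β γ z)
    then Fs α β y * Gs β γ z else 0ℤ

identity : ∀ {n m} → Series n m
identity α β [] = if ⌊ α ≟ᶠ β ⌋ then 1ℤ else 0ℤ
identity α β (_ ∷ _) = 0ℤ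

zeta : ∀ {n m} {I : Fin n → Fin n → Bool} → PartialAction I m → Series n m
zeta A α β x = if inM A α β x then 1ℤ else 0ℤ

mobius : ∀ {n m} (I : Fin n → Fin n → Bool) → PartialAction I m → Series n m
mobius I A α β x =
  if (⌊ isClique? I x ⌋ ∧ inM A α β x) then (- 1ℤ) ^ length x else 0ℤ

_≋_ : ∀ {n m} → Series n m → Series n m → Set
F ≋ G = ∀ α β x → F α β x ≡ G α β x

-- Summing over the intermediate state β takes the action out of the product:
-- (μζ)_{α,γ}(x) = ζ_{α,γ}(x) · Σ_{y·z = x} μ(y), where μ(y) = (-1)^|y| on cliques and 0
-- otherwise.  For x ≠ 1 the inner sum runs over the cliques y ≤ x and vanishes: if a is a
-- minimal letter of x, a clique y ∌ a lies below x exactly when a·y does, and the two terms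
-- cancel.  As traces are represented by chosen words, this pairing is carried out by
-- comparing the sums over R and over a·R, both of which represent every class that matters.
-- For ζμ one reverses all words, which swaps prefixes and suffixes.
module Submission where

open import Defs
open import Level using (0ℓ)
open import Function using (id; _∘_; _⇔_; mk⇔; Equivalence)
open import Data.Nat using (ℕ; suc; _≤_; s≤s)
open import Data.Nat.Properties using (≤-refl; ≤-trans; ≤-reflexive; m≤m+n; m≤n+m; n≤1+n)
open import Data.Integer using (ℤ; _+_; _-_; _*_; -_; _^_; 0ℤ; 1ℤ; -1ℤ)
import Data.Integer.Properties as ℤ
open import Algebra.Properties.CommutativeSemigroup ℤ.+-commutativeSemigroup using (interchange)
open import Data.Bool using (Bool; true; false; if_then_else_; _∧_)
open import Data.Bool.Properties using (∧-identityʳ)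
open import Data.Fin using (Fin)
open import Data.Fin.Properties using () renaming (_≟_ to _≟ᶠ_)
open import Data.Maybe using (just; nothing)
open import Data.Maybe.Properties using () renaming (≡-dec to ≡-decᴹ)
open import Data.Product using (_×_; _,_; ∃; proj₁; proj₂)
open import Data.Sum using (_⊎_; inj₁; inj₂)
open import Data.List using (List; []; _∷_; _++_; map; length; reverse; concatMap; upTo; allFin)
open import Data.List.Properties using (++-assoc; length-++; reverse-++; reverse-involutive; length-reverse; unfold-reverse)
open import Data.List.Relation.Unary.All as All using (All; []; _∷_)
import Data.List.Relation.Unary.All.Properties as All
open import Data.List.Relation.Unary.Any as Any using (Any; here; there; any?)
open import Data.List.Relation.Unary.AllPairs as AllPairs using (AllPairs; []; _∷_)
import Data.List.Relation.Unary.AllPairs.Properties as AllPairs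
import Data.List.Relation.Unary.Unique.Setoid as UniqueSetoid
import Data.List.Relation.Unary.Unique.Setoid.Properties as Unique
open import Data.List.Relation.Unary.Unique.DecSetoid.Properties using (deduplicate-!)
open import Data.List.Relation.Unary.Unique.Propositional using () renaming (Unique to Unique≡)
open import Data.List.Relation.Unary.Unique.Propositional.Properties using (allFin⁺)
open import Data.List.Membership.Propositional using (_∈_; _∉_; lose)
open import Data.List.Membership.Propositional.Properties using (∈-allFin; ∈-concatMap⁺; ∈-map⁺; ∈-upTo⁺)
import Data.List.Membership.Setoid as SetoidMembership
import Data.List.Membership.Setoid.Properties as SetoidMembershipₚ
open import Data.List.Relation.Binary.Permutation.Propositional using (_↭_; ↭-refl; ↭-sym; ↭-swap; ↭-isEquivalence)
open import Data.List.Relation.Binary.Permutation.Propositional.Properties using (++⁺ˡ; ∈-resp-↭; ↭-length; All-resp-↭; ↭-reverse)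
open import Relation.Nullary using (¬_; Dec; yes; no; contradiction; _×-dec_; map′)
open import Relation.Nullary.Decidable using (⌊_⌋; ⌊⌋-map′)
open import Relation.Unary using () renaming (Decidable to Decidable₁)
open import Relation.Binary using (Rel; Decidable; Setoid; DecSetoid; DecidableEquality)
open import Relation.Binary.PropositionalEquality
  using (_≡_; _≢_; refl; sym; trans; cong; cong₂; subst; subst₂; module ≡-Reasoning)
  renaming (isEquivalence to ≡-isEquivalence)
open import Relation.Binary.Construct.Closure.ReflexiveTransitive using (ε; _◅_)
open import Relation.Binary.Construct.Closure.Symmetric using (fwd; bwd)
import Relation.Binary.Construct.Closure.Equivalence as EqClosure

open ≡-Reasoning

if-yes : ∀ {P : Set} (p : Dec P) {u v : ℤ} → P → (if ⌊ p ⌋ then u else v) ≡ u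
if-yes (yes _) x = refl
if-yes (no ¬x) x = contradiction x ¬x

if-no : ∀ {P : Set} (p : Dec P) {u v : ℤ} → ¬ P → (if ⌊ p ⌋ then u else v) ≡ v
if-no (yes x) ¬x = contradiction x ¬x
if-no (no _)  ¬x = refl

⌊⌋-⇔ : ∀ {P Q : Set} → P ⇔ Q → (p : Dec P) (q : Dec Q) → ⌊ p ⌋ ≡ ⌊ q ⌋
⌊⌋-⇔ P⇔Q (yes p) (yes q) = refl
⌊⌋-⇔ P⇔Q (yes p) (no ¬q) = contradiction (Equivalence.to P⇔Q p) ¬q
⌊⌋-⇔ P⇔Q (no ¬p) (yes q) = contradiction (Equivalence.from P⇔Q q) ¬p
⌊⌋-⇔ P⇔Q (no ¬p) (no ¬q) = refl

if-∧ : ∀ b c {u v : ℤ} → (if b ∧ c then u else v) ≡ (if b then (if c then u else v) else v)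
if-∧ true  c = refl
if-∧ false c = refl

if-* : ∀ b (v : ℤ) → (if b then v else 0ℤ) ≡ (if b then 1ℤ else 0ℤ) * v
if-* true  v = sym (ℤ.*-identityˡ v)
if-* false v = sym (ℤ.*-zeroˡ v)

if-0 : ∀ b → (if b then 0ℤ else 0ℤ) ≡ 0ℤ
if-0 true  = refl
if-0 false = refl

-- Finite sums

module _ {A : Set} where

  ∑-cong : ∀ (xs : List A) {f g : A → ℤ} → (∀ x → f x ≡ g x) → ∑ xs f ≡ ∑ xs g
  ∑-cong []       f≗g = refl
  ∑-cong (x ∷ xs) f≗g = cong₂ _+_ (f≗g x) (∑-cong xs f≗g)

  ∑-0 : ∀ (xs : List A) → ∑ xs (λ _ → 0ℤ) ≡ 0ℤ
  ∑-0 []       = refl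
  ∑-0 (x ∷ xs) = trans (ℤ.+-identityˡ _) (∑-0 xs)

  ∑-+ : ∀ (xs : List A) (f g : A → ℤ) → ∑ xs (λ x → f x + g x) ≡ ∑ xs f + ∑ xs g
  ∑-+ []       f g = refl
  ∑-+ (x ∷ xs) f g =
    trans (cong (f x + g x +_) (∑-+ xs f g)) (interchange (f x) (g x) (∑ xs f) (∑ xs g))

  ∑-neg : ∀ (xs : List A) (f : A → ℤ) → ∑ xs (λ x → - f x) ≡ - ∑ xs f
  ∑-neg []       f = refl
  ∑-neg (x ∷ xs) f = trans (cong (- f x +_) (∑-neg xs f)) (sym (ℤ.neg-distrib-+ (f x) _))

  ∑-sub : ∀ (xs : List A) (f g : A → ℤ) → ∑ xs (λ x → f x - g x) ≡ ∑ xs f - ∑ xs g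
  ∑-sub xs f g = trans (∑-+ xs f (λ x → - g x)) (cong (∑ xs f +_) (∑-neg xs g))

  ∑-scale : ∀ (xs : List A) (c : ℤ) (f : A → ℤ) → ∑ xs (λ x → c * f x) ≡ c * ∑ xs f
  ∑-scale []       c f = sym (ℤ.*-zeroʳ c)
  ∑-scale (x ∷ xs) c f =
    trans (cong (c * f x +_) (∑-scale xs c f)) (sym (ℤ.*-distribˡ-+ c (f x) _))

  ∑-if : ∀ (xs : List A) b (f : A → ℤ) → ∑ xs (λ x → if b then f x else 0ℤ) ≡ (if b then ∑ xs f else 0ℤ)
  ∑-if xs true  f = refl
  ∑-if xs false f = ∑-0 xs

  ∑-if-atMostOne : ∀ {Q : A → Set} (Q? : Decidable₁ Q) {xs : List A} (v : ℤ) →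
                   AllPairs (λ x y → ¬ (Q x × Q y)) xs →
                   ∑ xs (λ x → if ⌊ Q? x ⌋ then v else 0ℤ) ≡ (if ⌊ any? Q? xs ⌋ then v else 0ℤ)
  ∑-if-atMostOne Q? v [] = refl
  ∑-if-atMostOne Q? {x ∷ xs} v (x-alone ∷ pairs)
    with Q? x | any? Q? xs | ∑-if-atMostOne Q? v pairs
  ... | yes q  | yes q′ | _  = contradiction q′ (All.All¬⇒¬Any (All.map (λ ¬both q″ → ¬both (q , q″)) x-alone))
  ... | yes _  | no _   | ih = trans (cong (v +_) ih) (ℤ.+-identityʳ v)
  ... | no _   | yes _  | ih = trans (ℤ.+-identityˡ _) ih
  ... | no _   | no _   | ih = trans (ℤ.+-identityˡ _) ih

  ∑-δ : ∀ (_≟_ : DecidableEquality A) {xs} → Unique≡ xs → ∀ {b} → b ∈ xs → (f : A → ℤ) →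
        ∑ xs (λ x → if ⌊ b ≟ x ⌋ then f x else 0ℤ) ≡ f b
  ∑-δ _≟_ {xs} xs! {b} b∈xs f = begin
    ∑ xs (λ x → if ⌊ b ≟ x ⌋ then f x else 0ℤ) ≡⟨ ∑-cong xs at-b ⟩
    ∑ xs (λ x → if ⌊ b ≟ x ⌋ then f b else 0ℤ) ≡⟨ ∑-if-atMostOne (b ≟_) (f b) (AllPairs.map distinct xs!) ⟩
    (if ⌊ any? (b ≟_) xs ⌋ then f b else 0ℤ)  ≡⟨ if-yes (any? (b ≟_) xs) b∈xs ⟩
    f b                                       ∎
    where
    at-b : ∀ x → (if ⌊ b ≟ x ⌋ then f x else 0ℤ) ≡ (if ⌊ b ≟ x ⌋ then f b else 0ℤ)
    at-b x with b ≟ x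
    ... | yes refl = refl
    ... | no _     = refl
    distinct : ∀ {x y} → x ≢ y → ¬ (b ≡ x × b ≡ y)
    distinct x≢y (refl , refl) = x≢y refl

∑-swap : ∀ {A B : Set} (xs : List A) (ys : List B) (f : A → B → ℤ) →
         ∑ xs (λ x → ∑ ys (f x)) ≡ ∑ ys (λ y → ∑ xs (λ x → f x y))
∑-swap []       ys f = sym (∑-0 ys)
∑-swap (x ∷ xs) ys f =
  trans (cong (∑ ys (f x) +_) (∑-swap xs ys f)) (sym (∑-+ ys (f x) (λ y → ∑ xs (λ x → f x y))))

∑-map : ∀ {A B : Set} (h : A → B) (xs : List A) (f : B → ℤ) → ∑ (map h xs) f ≡ ∑ xs (f ∘ h)
∑-map h []       f = refl
∑-map h (x ∷ xs) f = cong (f (h x) +_) (∑-map h xs f)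

module _ (D : DecSetoid 0ℓ 0ℓ) where
  private module D = DecSetoid D
  open D using (Carrier; _≈_; _≟_)
  open UniqueSetoid D.setoid using (Unique)
  open SetoidMembership D.setoid using () renaming (_∈_ to _∈ₛ_)

  ∑-class : ∀ {xs} → Unique xs → ∀ {x} {v : ℤ} → v ≡ 0ℤ ⊎ x ∈ₛ xs →
            ∑ xs (λ y → if ⌊ x ≟ y ⌋ then v else 0ℤ) ≡ v
  ∑-class {xs} xs! {x} {v} x∈xs =
    trans (∑-if-atMostOne (x ≟_) v (AllPairs.map (λ y≉z (x≈y , x≈z) → y≉z (D.trans (D.sym x≈y) x≈z)) xs!))
          (represented x∈xs)
    where
    represented : v ≡ 0ℤ ⊎ x ∈ₛ xs → (if ⌊ any? (x ≟_) xs ⌋ then v else 0ℤ) ≡ v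
    represented (inj₁ refl) = if-0 _
    represented (inj₂ x∈)   = if-yes (any? (x ≟_) xs) x∈

  ∑-reindex : ∀ {xs ys} (g : Carrier → ℤ) → (∀ {x y} → x ≈ y → g x ≡ g y) →
              Unique xs → Unique ys →
              (∀ x → g x ≡ 0ℤ ⊎ x ∈ₛ ys) → (∀ y → g y ≡ 0ℤ ⊎ y ∈ₛ xs) →
              ∑ xs g ≡ ∑ ys g
  ∑-reindex {xs} {ys} g g-resp xs! ys! xs⊆ys ys⊆xs = begin
    ∑ xs g                                                      ≡⟨ ∑-cong xs (λ x → sym (∑-class ys! (xs⊆ys x))) ⟩
    ∑ xs (λ x → ∑ ys (λ y → if ⌊ x ≟ y ⌋ then g x else 0ℤ)) ≡⟨ ∑-swap xs ys (λ x y → if ⌊ x ≟ y ⌋ then g x else 0ℤ) ⟩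
    ∑ ys (λ y → ∑ xs (λ x → if ⌊ x ≟ y ⌋ then g x else 0ℤ)) ≡⟨ ∑-cong ys (λ y → ∑-cong xs (λ x → flip x y)) ⟩
    ∑ ys (λ y → ∑ xs (λ x → if ⌊ y ≟ x ⌋ then g y else 0ℤ)) ≡⟨ ∑-cong ys (λ y → ∑-class xs! (ys⊆xs y)) ⟩
    ∑ ys g                                                      ∎
    where
    flip : ∀ x y → (if ⌊ x ≟ y ⌋ then g x else 0ℤ) ≡ (if ⌊ y ≟ x ⌋ then g y else 0ℤ)
    flip x y with x ≟ y | y ≟ x
    ... | yes x≈y | yes _   = g-resp x≈y
    ... | yes x≈y | no y≉x  = contradiction (D.sym x≈y) y≉x
    ... | no x≉y  | yes y≈x = contradiction (D.sym y≈x) x≉y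
    ... | no _    | no _    = refl

module Trace {n : ℕ} (I : Fin n → Fin n → Bool)
             (irreflexive : Irreflexiveᴵ I) (symmetric : Symmetricᴵ I) where

  Word : Set
  Word = List (Fin n)

  ∼-setoid : Setoid 0ℓ 0ℓ
  ∼-setoid = EqClosure.setoid (Swap I)

  open Setoid ∼-setoid public using () renaming (refl to ∼-refl; sym to ∼-sym; trans to ∼-trans)
  open UniqueSetoid ∼-setoid public using (Unique)
  open SetoidMembership ∼-setoid public using () renaming (_∈_ to _∈ₜ_)

  infix 4 _∼_ _≼_

  _∼_ : Rel Word 0ℓ
  u ∼ v = u ∼[ I ] v

  _≼_ : Word → Word → Set
  y ≼ x = ∃ λ z → y ++ z ∼ x

  independent⇒≢ : ∀ {a b} → I a b ≡ true → a ≢ b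
  independent⇒≢ {a} Iab refl with trans (sym Iab) (irreflexive a)
  ... | ()

  independent-sym : ∀ {a b} → I a b ≡ true → I b a ≡ true
  independent-sym {a} {b} Iab = trans (symmetric b a) Iab

  swap-sym : ∀ {u v} → Swap I u v → Swap I v u
  swap-sym (swap p q a b Iab) = swap p q b a (independent-sym Iab)

  ∼-preserves : (P : Word → Set) → (∀ {u v} → Swap I u v → P u → P v) → ∀ {u v} → u ∼ v → P u → P v
  ∼-preserves P step ε            pu = pu
  ∼-preserves P step (fwd s ◅ ss) pu = ∼-preserves P step ss (step s pu)
  ∼-preserves P step (bwd s ◅ ss) pu = ∼-preserves P step ss (step (swap-sym s) pu)

  swap-++ˡ : ∀ w {u v} → Swap I u v → Swap I (w ++ u) (w ++ v)
  swap-++ˡ w (swap p q a b Iab) =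
    subst₂ (Swap I) (++-assoc w p (a ∷ b ∷ q)) (++-assoc w p (b ∷ a ∷ q)) (swap (w ++ p) q a b Iab)

  swap-++ʳ : ∀ w {u v} → Swap I u v → Swap I (u ++ w) (v ++ w)
  swap-++ʳ w (swap p q a b Iab) =
    subst₂ (Swap I) (sym (++-assoc p (a ∷ b ∷ q) w)) (sym (++-assoc p (b ∷ a ∷ q) w)) (swap p (q ++ w) a b Iab)

  ∼-++ˡ : ∀ w {u v} → u ∼ v → w ++ u ∼ w ++ v
  ∼-++ˡ w = EqClosure.gmap (w ++_) (swap-++ˡ w)

  ∼-++ʳ : ∀ w {u v} → u ∼ v → u ++ w ∼ v ++ w
  ∼-++ʳ w = EqClosure.gmap (_++ w) (swap-++ʳ w)

  ∼-∷ : ∀ c {u v} → u ∼ v → c ∷ u ∼ c ∷ v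
  ∼-∷ c = ∼-++ˡ (c ∷ [])

  swap⇒∼ : ∀ {u v} → Swap I u v → u ∼ v
  swap⇒∼ s = fwd s ◅ ε

  ∼⇒↭ : ∀ {u v} → u ∼ v → u ↭ v
  ∼⇒↭ = EqClosure.gfold ↭-isEquivalence id (λ { (swap p q a b _) → ++⁺ˡ p (↭-swap a b ↭-refl) })

  ∼-length : ∀ {u v} → u ∼ v → length u ≡ length v
  ∼-length = ↭-length ∘ ∼⇒↭

  ∼-∈ : ∀ {c u v} → u ∼ v → c ∈ u → c ∈ v
  ∼-∈ = ∈-resp-↭ ∘ ∼⇒↭

  ≼-length : ∀ {y x} → y ≼ x → length y ≤ length x
  ≼-length {y} (z , yz∼x) = ≤-trans (m≤m+n (length y) (length z)) (≤-reflexive (trans (sym (length-++ y)) (∼-length yz∼x)))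

  suffix-length : ∀ {y z x} → y ++ z ∼ x → length z ≤ length x
  suffix-length {y} {z} yz∼x = ≤-trans (m≤n+m (length z) (length y)) (≤-reflexive (trans (sym (length-++ y)) (∼-length yz∼x)))

  ≼-resp : ∀ {y y′ x} → y ∼ y′ → y ≼ x → y′ ≼ x
  ≼-resp {y} y∼y′ (z , yz∼x) = z , ∼-trans (∼-++ʳ z (∼-sym y∼y′)) yz∼x

  delete : Fin n → Word → Word
  delete a []      = []
  delete a (b ∷ w) with a ≟ᶠ b
  ... | yes _ = w
  ... | no _  = b ∷ delete a w

  delete-head : ∀ {a b} w → a ≡ b → delete a (b ∷ w) ≡ w
  delete-head {a} {b} w a≡b with a ≟ᶠ b
  ... | yes _   = refl
  ... | no a≢b = contradiction a≡b a≢b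

  delete-∷ : ∀ {a b} w → a ≢ b → delete a (b ∷ w) ≡ b ∷ delete a w
  delete-∷ {a} {b} w a≢b with a ≟ᶠ b
  ... | yes a≡b = contradiction a≡b a≢b
  ... | no _    = refl

  delete-swap : ∀ a {u v} → Swap I u v → delete a u ∼ delete a v
  delete-swap a (swap p q c d Icd) = go p
    where
    go : ∀ p → delete a (p ++ c ∷ d ∷ q) ∼ delete a (p ++ d ∷ c ∷ q)
    go (x ∷ p) with a ≟ᶠ x
    ... | yes _ = swap⇒∼ (swap p q c d Icd)
    ... | no _  = ∼-∷ x (go p)
    go [] with a ≟ᶠ c | a ≟ᶠ d
    ... | yes a≡c | yes a≡d = contradiction (trans (sym a≡c) a≡d) (independent⇒≢ Icd)
    ... | yes a≡c | no _    = subst (λ t → d ∷ q ∼ d ∷ t) (sym (delete-head q a≡c)) ∼-refl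
    ... | no _    | yes a≡d = subst (λ t → c ∷ t ∼ c ∷ q) (sym (delete-head q a≡d)) ∼-refl
    ... | no a≢c  | no a≢d  =
      subst₂ (λ t t′ → c ∷ t ∼ d ∷ t′) (sym (delete-∷ q a≢d)) (sym (delete-∷ q a≢c))
             (swap⇒∼ (swap [] (delete a q) c d Icd))

  ∼-delete : ∀ a {u v} → u ∼ v → delete a u ∼ delete a v
  ∼-delete a = EqClosure.gfold (Setoid.isEquivalence ∼-setoid) (delete a) (delete-swap a)

  ∼-cancel-∷ : ∀ a {u v} → a ∷ u ∼ a ∷ v → u ∼ v
  ∼-cancel-∷ a {u} {v} = subst₂ _∼_ (delete-head u refl) (delete-head v refl) ∘ ∼-delete a

  ∼-cancelˡ : ∀ w {u v} → w ++ u ∼ w ++ v → u ∼ v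
  ∼-cancelˡ []      = id
  ∼-cancelˡ (a ∷ w) = ∼-cancelˡ w ∘ ∼-cancel-∷ a

  data Minimal (a : Fin n) : Word → Set where
    min-head : ∀ {w} → Minimal a (a ∷ w)
    min-skip : ∀ {b w} → I b a ≡ true → Minimal a w → Minimal a (b ∷ w)

  minimal-swap : ∀ {a u v} → Swap I u v → Minimal a u → Minimal a v
  minimal-swap {a} (swap p q c d Icd) = go p
    where
    go : ∀ p → Minimal a (p ++ c ∷ d ∷ q) → Minimal a (p ++ d ∷ c ∷ q)
    go (x ∷ p) min-head                            = min-head
    go (x ∷ p) (min-skip Ixa m)                    = min-skip Ixa (go p m)
    go []      min-head                            = min-skip (independent-sym Icd) min-head
    go []      (min-skip Ica min-head)             = min-head
    go []      (min-skip Ica (min-skip Ida m))     = min-skip Ida (min-skip Ica m)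

  minimal-resp : ∀ {a u v} → u ∼ v → Minimal a u → Minimal a v
  minimal-resp {a} = ∼-preserves (Minimal a) minimal-swap

  minimal-++ : ∀ {a} y {z} → a ∉ y → Minimal a (y ++ z) → All (λ c → I c a ≡ true) y × Minimal a z
  minimal-++ []      a∉y m                = [] , m
  minimal-++ (b ∷ y) a∉y min-head         = contradiction (here refl) a∉y
  minimal-++ (b ∷ y) a∉y (min-skip Iba m) with minimal-++ y (a∉y ∘ there) m
  ... | y∥a , mz = Iba ∷ y∥a , mz

  minimal⇒∼∷ : ∀ {a w} → Minimal a w → w ∼ a ∷ delete a w
  minimal⇒∼∷ {a} (min-head {w}) = subst (λ t → a ∷ w ∼ a ∷ t) (sym (delete-head w refl)) ∼-refl
  minimal⇒∼∷ {a} (min-skip {b} {w} Iba m) =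
    subst (λ t → b ∷ w ∼ a ∷ t) (sym (delete-∷ w (independent⇒≢ (independent-sym Iba))))
          (∼-trans (∼-∷ b (minimal⇒∼∷ m)) (swap⇒∼ (swap [] (delete a w) b a Iba)))

  ∷-commute : ∀ {a} y w → All (λ c → I a c ≡ true) y → y ++ a ∷ w ∼ a ∷ y ++ w
  ∷-commute []      w []           = ∼-refl
  ∷-commute (c ∷ y) w (Iac ∷ a∥y) =
    ∼-trans (∼-∷ c (∷-commute y w a∥y)) (swap⇒∼ (swap [] (y ++ w) c _ (independent-sym Iac)))

  independent⇒∥ : ∀ {a b} → I a b ≡ true → a ≢ b × I a b ≡ true
  independent⇒∥ Iab = independent⇒≢ Iab , Iab

  clique-swap : ∀ {u v} → Swap I u v → IsClique I u → IsClique I v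
  clique-swap (swap p q c d Icd) = go p
    where
    go : ∀ p → IsClique I (p ++ c ∷ d ∷ q) → IsClique I (p ++ d ∷ c ∷ q)
    go (x ∷ p) (x∥ ∷ cl) = All-resp-↭ (++⁺ˡ p (↭-swap c d ↭-refl)) x∥ ∷ go p cl
    go [] ((c∥d ∷ c∥q) ∷ (d∥q ∷ cl)) =
      (independent⇒∥ (independent-sym Icd) ∷ d∥q) ∷ (c∥q ∷ cl)

  clique-resp : ∀ {u v} → u ∼ v → IsClique I u → IsClique I v
  clique-resp = ∼-preserves (IsClique I) clique-swap

  clique⇒minimal : ∀ {a w} → IsClique I w → a ∈ w → Minimal a w
  clique⇒minimal (w∥ ∷ cl) (here refl) = min-head
  clique⇒minimal (w∥ ∷ cl) (there a∈w) = min-skip (proj₂ (All.lookup w∥ a∈w)) (clique⇒minimal cl a∈w)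

  clique-∷⇒∉ : ∀ {a y} → IsClique I (a ∷ y) → a ∉ y
  clique-∷⇒∉ (a∥y ∷ _) a∈y = proj₁ (All.lookup a∥y a∈y) refl

  swap-reverse : ∀ {u v} → Swap I u v → Swap I (reverse u) (reverse v)
  swap-reverse (swap p q a b Iab) =
    subst₂ (Swap I) (sym (reverse-swap a b)) (sym (reverse-swap b a)) (swap (reverse q) (reverse p) b a (independent-sym Iab))
    where
    reverse-swap : ∀ a b → reverse (p ++ a ∷ b ∷ q) ≡ reverse q ++ b ∷ a ∷ reverse p
    reverse-swap a b = begin
      reverse (p ++ a ∷ b ∷ q)                       ≡⟨ reverse-++ p (a ∷ b ∷ q) ⟩
      reverse (a ∷ b ∷ q) ++ reverse p
        ≡⟨ cong (_++ reverse p) (trans (unfold-reverse a (b ∷ q)) (cong (_++ a ∷ []) (unfold-reverse b q))) ⟩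
      ((reverse q ++ b ∷ []) ++ a ∷ []) ++ reverse p ≡⟨ ++-assoc (reverse q ++ b ∷ []) (a ∷ []) (reverse p) ⟩
      (reverse q ++ b ∷ []) ++ a ∷ reverse p         ≡⟨ ++-assoc (reverse q) (b ∷ []) (a ∷ reverse p) ⟩
      reverse q ++ b ∷ a ∷ reverse p                 ∎

  ∼-reverse : ∀ {u v} → u ∼ v → reverse u ∼ reverse v
  ∼-reverse = EqClosure.gmap reverse swap-reverse

  ∼-reverse⁻ : ∀ {u v} → reverse u ∼ reverse v → u ∼ v
  ∼-reverse⁻ {u} {v} = subst₂ _∼_ (reverse-involutive u) (reverse-involutive v) ∘ ∼-reverse

  clique-reverse : ∀ {w} → IsClique I w → IsClique I (reverse w)
  clique-reverse []                = []
  clique-reverse {c ∷ w} (c∥w ∷ cl) = subst (IsClique I) (sym (unfold-reverse c w))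
    (AllPairs.++⁺ (clique-reverse cl) ([] ∷ []) (All.map (λ c∥x → ∥-sym c∥x ∷ []) (All-resp-↭ (↭-sym (↭-reverse w)) c∥w)))
    where
    ∥-sym : ∀ {a b} → a ≢ b × I a b ≡ true → b ≢ a × I b a ≡ true
    ∥-sym (a≢b , Iab) = a≢b ∘ sym , independent-sym Iab

  clique-reverse⁻ : ∀ {w} → IsClique I (reverse w) → IsClique I w
  clique-reverse⁻ {w} = subst (IsClique I) (reverse-involutive w) ∘ clique-reverse

module Factorisations {n : ℕ} (I : Fin n → Fin n → Bool)
                      (irreflexive : Irreflexiveᴵ I) (symmetric : Symmetricᴵ I)
                      (_≟_ : Decidable (_∼[ I ]_)) where

  open Trace I irreflexive symmetric
  open import Data.List.Membership.DecPropositional (_≟ᶠ_ {n}) using (_∈?_)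

  ∼-decSetoid : DecSetoid 0ℓ 0ℓ
  ∼-decSetoid = record { isDecEquivalence = record { isEquivalence = Setoid.isEquivalence ∼-setoid ; _≟_ = _≟_ } }

  record Representatives (L : ℕ) (R : List Word) : Set where
    field
      unique   : Unique R
      complete : ∀ {w} → length w ≤ L → w ∈ₜ R

  ∈-allWords : ∀ (w : Word) → w ∈ allWords (length w)
  ∈-allWords []      = here refl
  ∈-allWords (c ∷ w) =
    ∈-concatMap⁺ (λ a → map (a ∷_) (allWords (length w))) (lose (∈-allFin c) (∈-map⁺ (c ∷_) (∈-allWords w)))

  traceReps-representatives : ∀ L → Representatives L (traceReps _≟_ L)
  traceReps-representatives L = record
    { unique   = deduplicate-! ∼-decSetoid (concatMap allWords (upTo (suc L)))
    ; complete = λ {w} w≤L →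
        SetoidMembershipₚ.∈-deduplicate⁺ ∼-setoid _≟_ (λ y′∼y w∼y → ∼-trans w∼y (∼-sym y′∼y))
          (Any.map (Setoid.reflexive ∼-setoid) (∈-concatMap⁺ allWords (lose (∈-upTo⁺ (s≤s w≤L)) (∈-allWords w))))
    }

  representatives-reverse : ∀ {L R} → Representatives L R → Representatives L (map reverse R)
  representatives-reverse {L} {R} reps = record
    { unique   = Unique.map⁺ ∼-setoid ∼-setoid ∼-reverse⁻ unique
    ; complete = λ {w} w≤L →
        SetoidMembershipₚ.∈-resp-≈ ∼-setoid {map reverse R} (Setoid.reflexive ∼-setoid (reverse-involutive w))
          (SetoidMembershipₚ.∈-map⁺ ∼-setoid ∼-setoid ∼-reverse
            (complete {reverse w} (≤-trans (≤-reflexive (length-reverse w)) w≤L)))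
    }
    where open Representatives reps

  ∑-factorisations : List Word → Word → (Word → Word → ℤ) → ℤ
  ∑-factorisations R x c = ∑ R λ y → ∑ R λ z → if ⌊ (y ++ z) ≟ x ⌋ then c y z else 0ℤ

  μ : Word → ℤ
  μ w = if ⌊ isClique? I w ⌋ then -1ℤ ^ length w else 0ℤ

  μ-reverse : ∀ w → μ (reverse w) ≡ μ w
  μ-reverse w = cong₂ (λ b k → if b then -1ℤ ^ k else 0ℤ)
    (⌊⌋-⇔ (mk⇔ clique-reverse⁻ clique-reverse) (isClique? I (reverse w)) (isClique? I w)) (length-reverse w)

  module Alternating {L R} (reps : Representatives L R) {x : Word} (x≤L : length x ≤ L) where
    open Representatives reps

    prefix? : ∀ y → Dec (y ≼ x)
    prefix? y = map′ Any.satisfied represent (any? (λ z → (y ++ z) ≟ x) R)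
      where
      represent : y ≼ x → Any (λ z → y ++ z ∼ x) R
      represent (z , yz∼x) =
        Any.map (λ z∼r → ∼-trans (∼-++ˡ y (∼-sym z∼r)) yz∼x)
                (complete (≤-trans (suffix-length {y} yz∼x) x≤L))

    ∑-prefix : ∀ y v → ∑ R (λ z → if ⌊ (y ++ z) ≟ x ⌋ then v else 0ℤ) ≡ (if ⌊ prefix? y ⌋ then v else 0ℤ)
    ∑-prefix y v = trans
      (∑-if-atMostOne (λ z → (y ++ z) ≟ x) v
        (AllPairs.map (λ z≁z′ (p , p′) → z≁z′ (∼-cancelˡ y (∼-trans p (∼-sym p′)))) unique))
      (cong (λ b → if b then v else 0ℤ) (sym (⌊⌋-map′ _ _ (any? (λ z → (y ++ z) ≟ x) R))))

    μ≼ : Word → ℤ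
    μ≼ y = if ⌊ isClique? I y ×-dec prefix? y ⌋ then -1ℤ ^ length y else 0ℤ

    ∑-factorisations-μ : ∑-factorisations R x (λ y _ → μ y) ≡ ∑ R μ≼
    ∑-factorisations-μ = ∑-cong R λ y → trans (∑-prefix y (μ y)) (nested (isClique? I y) (prefix? y))
      where
      nested : ∀ {P Q : Set} (p : Dec P) (q : Dec Q) {s : ℤ} →
               (if ⌊ q ⌋ then (if ⌊ p ⌋ then s else 0ℤ) else 0ℤ) ≡ (if ⌊ p ×-dec q ⌋ then s else 0ℤ)
      nested (yes _) (yes _) = refl
      nested (yes _) (no _)  = refl
      nested (no _)  (yes _) = refl
      nested (no _)  (no _)  = refl

    μ≼-resp : ∀ {y y′} → y ∼ y′ → μ≼ y ≡ μ≼ y′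
    μ≼-resp y∼y′ = cong₂ (λ b k → if b then -1ℤ ^ k else 0ℤ)
      (⌊⌋-⇔ (mk⇔ (transport y∼y′) (transport (∼-sym y∼y′))) _ _) (∼-length y∼y′)
      where
      transport : ∀ {y y′} → y ∼ y′ → IsClique I y × y ≼ x → IsClique I y′ × y′ ≼ x
      transport y∼y′ (cl , y≼x) = clique-resp y∼y′ cl , ≼-resp y∼y′ y≼x

    μ≼-support : ∀ y → μ≼ y ≡ 0ℤ ⊎ IsClique I y × y ≼ x
    μ≼-support y with isClique? I y ×-dec prefix? y
    ... | yes cp = inj₂ cp
    ... | no _   = inj₁ refl

    module _ {a} (a-minimal : Minimal a x) where

      clique-≼-∷ : ∀ {y} → a ∉ y → (IsClique I (a ∷ y) × a ∷ y ≼ x) ⇔ (IsClique I y × y ≼ x)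
      clique-≼-∷ {y} a∉y = mk⇔ drop-a add-a
        where
        drop-a : IsClique I (a ∷ y) × a ∷ y ≼ x → IsClique I y × y ≼ x
        drop-a (a∥y ∷ cl , z , ayz∼x) = cl , a ∷ z , ∼-trans (∷-commute y z (All.map proj₂ a∥y)) ayz∼x
        add-a : IsClique I y × y ≼ x → IsClique I (a ∷ y) × a ∷ y ≼ x
        add-a (cl , z , yz∼x) with minimal-++ y a∉y (minimal-resp (∼-sym yz∼x) a-minimal)
        ... | y∥a , z-minimal =
          All.map (independent⇒∥ ∘ independent-sym) y∥a ∷ cl ,
          delete a z ,
          ∼-trans (∼-sym (∷-commute y (delete a z) (All.map independent-sym y∥a)))
                  (∼-trans (∼-++ˡ y (∼-sym (minimal⇒∼∷ z-minimal))) yz∼x)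

      μ≼-∷ : ∀ {y} → a ∉ y → μ≼ (a ∷ y) ≡ - μ≼ y
      μ≼-∷ {y} a∉y = trans
        (cong (λ b → if b then -1ℤ * -1ℤ ^ length y else 0ℤ) (⌊⌋-⇔ (clique-≼-∷ a∉y) _ _))
        (negate (⌊ isClique? I y ×-dec prefix? y ⌋))
        where
        negate : ∀ b → (if b then -1ℤ * -1ℤ ^ length y else 0ℤ) ≡ - (if b then -1ℤ ^ length y else 0ℤ)
        negate true  = ℤ.-1*i≡-i _
        negate false = refl

      μ≼ᵃ : Word → ℤ
      μ≼ᵃ y = if ⌊ a ∈? y ⌋ then μ≼ y else 0ℤ

      -- The sign-reversing pairing y ↦ a ∷ y, in telescoping form.
      μ≼-split : ∀ y → μ≼ y ≡ μ≼ᵃ y - μ≼ᵃ (a ∷ y)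
      μ≼-split y = split (a ∈? y)
        where
        μ≼ᵃ-∷ : μ≼ᵃ (a ∷ y) ≡ μ≼ (a ∷ y)
        μ≼ᵃ-∷ = if-yes (a ∈? a ∷ y) (here refl)
        split : Dec (a ∈ y) → μ≼ y ≡ μ≼ᵃ y - μ≼ᵃ (a ∷ y)
        split (yes a∈y) = begin
          μ≼ y                ≡⟨ ℤ.+-identityʳ (μ≼ y) ⟨
          μ≼ y - 0ℤ           ≡⟨ cong (λ t → μ≼ y - t) (if-no (isClique? I (a ∷ y) ×-dec prefix? (a ∷ y))
                                                              (λ (cl , _) → clique-∷⇒∉ cl a∈y)) ⟨
          μ≼ y - μ≼ (a ∷ y)   ≡⟨ cong₂ _-_ (if-yes (a ∈? y) a∈y) μ≼ᵃ-∷ ⟨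
          μ≼ᵃ y - μ≼ᵃ (a ∷ y) ∎
        split (no a∉y) = begin
          μ≼ y                ≡⟨ ℤ.neg-involutive (μ≼ y) ⟨
          - - μ≼ y            ≡⟨ ℤ.+-identityˡ _ ⟨
          0ℤ - - μ≼ y         ≡⟨ cong (λ t → 0ℤ - t) (μ≼-∷ a∉y) ⟨
          0ℤ - μ≼ (a ∷ y)     ≡⟨ cong₂ _-_ (if-no (a ∈? y) a∉y) μ≼ᵃ-∷ ⟨
          μ≼ᵃ y - μ≼ᵃ (a ∷ y) ∎

      μ≼ᵃ-support : ∀ y → μ≼ᵃ y ≡ 0ℤ ⊎ a ∈ y × IsClique I y × y ≼ x
      μ≼ᵃ-support y with a ∈? y
      ... | no _    = inj₁ refl
      ... | yes a∈y with μ≼-support y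
      ...   | inj₁ μ≼y≡0    = inj₁ μ≼y≡0
      ...   | inj₂ (cl , p) = inj₂ (a∈y , cl , p)

      ∑-μ≼ᵃ-∷ : ∑ (map (a ∷_) R) μ≼ᵃ ≡ ∑ R μ≼ᵃ
      ∑-μ≼ᵃ-∷ = ∑-reindex ∼-decSetoid μ≼ᵃ μ≼ᵃ-resp (Unique.map⁺ ∼-setoid ∼-setoid (∼-cancel-∷ a) unique) unique
                          represented-in-R represented-in-a∷R
        where
        μ≼ᵃ-resp : ∀ {y y′} → y ∼ y′ → μ≼ᵃ y ≡ μ≼ᵃ y′
        μ≼ᵃ-resp {y} {y′} y∼y′ = cong₂ (λ b t → if b then t else 0ℤ)
          (⌊⌋-⇔ (mk⇔ (∼-∈ y∼y′) (∼-∈ (∼-sym y∼y′))) (a ∈? y) (a ∈? y′)) (μ≼-resp y∼y′)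
        represented-in-R : ∀ s → μ≼ᵃ s ≡ 0ℤ ⊎ s ∈ₜ R
        represented-in-R s with μ≼ᵃ-support s
        ... | inj₁ μ≼ᵃs≡0          = inj₁ μ≼ᵃs≡0
        ... | inj₂ (_ , _ , s≼x) = inj₂ (complete (≤-trans (≼-length s≼x) x≤L))
        represented-in-a∷R : ∀ r → μ≼ᵃ r ≡ 0ℤ ⊎ r ∈ₜ map (a ∷_) R
        represented-in-a∷R r with μ≼ᵃ-support r
        ... | inj₁ μ≼ᵃr≡0            = inj₁ μ≼ᵃr≡0
        ... | inj₂ (a∈r , cl , r≼x) = inj₂
          (SetoidMembershipₚ.∈-resp-≈ ∼-setoid {map (a ∷_) R} (∼-sym r∼a∷r′)
            (SetoidMembershipₚ.∈-map⁺ ∼-setoid ∼-setoid (∼-∷ a) (complete {delete a r} r′≤L)))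
          where
          r∼a∷r′ : r ∼ a ∷ delete a r
          r∼a∷r′ = minimal⇒∼∷ (clique⇒minimal cl a∈r)
          r′≤L : length (delete a r) ≤ L
          r′≤L = ≤-trans (n≤1+n _) (≤-trans (≤-reflexive (sym (∼-length r∼a∷r′))) (≤-trans (≼-length r≼x) x≤L))

      ∑-μ≼ : ∑ R μ≼ ≡ 0ℤ
      ∑-μ≼ = begin
        ∑ R μ≼                                ≡⟨ ∑-cong R μ≼-split ⟩
        ∑ R (λ y → μ≼ᵃ y - μ≼ᵃ (a ∷ y))       ≡⟨ ∑-sub R μ≼ᵃ (μ≼ᵃ ∘ (a ∷_)) ⟩
        ∑ R μ≼ᵃ - ∑ R (μ≼ᵃ ∘ (a ∷_))
          ≡⟨ cong (λ t → ∑ R μ≼ᵃ - t) (trans (sym (∑-map (a ∷_) R μ≼ᵃ)) ∑-μ≼ᵃ-∷) ⟩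
        ∑ R μ≼ᵃ - ∑ R μ≼ᵃ                     ≡⟨ ℤ.+-inverseʳ (∑ R μ≼ᵃ) ⟩
        0ℤ                                    ∎

  ∑-factorisations-μ-prefix : ∀ {L R} → Representatives L R → ∀ {x} → length x ≤ L → x ≢ [] →
                              ∑-factorisations R x (λ y _ → μ y) ≡ 0ℤ
  ∑-factorisations-μ-prefix reps {[]}    x≤L x≢[] = contradiction refl x≢[]
  ∑-factorisations-μ-prefix reps {a ∷ x} x≤L x≢[] = trans ∑-factorisations-μ (∑-μ≼ min-head)
    where open Alternating reps {a ∷ x} x≤L

  ∑-factorisations-reverse : ∀ R x → ∑-factorisations R x (λ _ z → μ z)
                                   ≡ ∑-factorisations (map reverse R) (reverse x) (λ y _ → μ y)
  ∑-factorisations-reverse R x = sym (begin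
    ∑ (map reverse R) (λ u → ∑ (map reverse R) (λ v → term u v))
      ≡⟨ ∑-map reverse R (λ u → ∑ (map reverse R) (λ v → term u v)) ⟩
    ∑ R (λ z → ∑ (map reverse R) (λ v → term (reverse z) v))
      ≡⟨ ∑-cong R (λ z → ∑-map reverse R (term (reverse z))) ⟩
    ∑ R (λ z → ∑ R (λ y → term (reverse z) (reverse y)))
      ≡⟨ ∑-swap R R (λ z y → term (reverse z) (reverse y)) ⟩
    ∑ R (λ y → ∑ R (λ z → term (reverse z) (reverse y)))
      ≡⟨ ∑-cong R (λ y → ∑-cong R (term-reverse y)) ⟩
    ∑-factorisations R x (λ _ z → μ z) ∎)
    where
    term : Word → Word → ℤ
    term u v = if ⌊ (u ++ v) ≟ reverse x ⌋ then μ u else 0ℤ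
    reversed : ∀ y z → (reverse z ++ reverse y ∼ reverse x) ⇔ (y ++ z ∼ x)
    reversed y z = mk⇔ (λ p → ∼-reverse⁻ (subst (_∼ reverse x) (sym (reverse-++ y z)) p))
                       (λ p → subst (_∼ reverse x) (reverse-++ y z) (∼-reverse p))
    term-reverse : ∀ y z → term (reverse z) (reverse y) ≡ (if ⌊ (y ++ z) ≟ x ⌋ then μ z else 0ℤ)
    term-reverse y z = cong₂ (λ b t → if b then t else 0ℤ)
      (⌊⌋-⇔ (reversed y z) ((reverse z ++ reverse y) ≟ reverse x) ((y ++ z) ≟ x)) (μ-reverse z)

  ∑-factorisations-μ-suffix : ∀ {L R} → Representatives L R → ∀ {x} → length x ≤ L → x ≢ [] →
                              ∑-factorisations R x (λ _ z → μ z) ≡ 0ℤ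
  ∑-factorisations-μ-suffix {R = R} reps {x} x≤L x≢[] = trans (∑-factorisations-reverse R x)
    (∑-factorisations-μ-prefix (representatives-reverse reps) {reverse x} (≤-trans (≤-reflexive (length-reverse x)) x≤L)
      (λ rx≡[] → x≢[] (trans (sym (reverse-involutive x)) (cong reverse rx≡[]))))

-- The action and the product of fibred series

module Action {n m : ℕ} {I : Fin n → Fin n → Bool}
              (irreflexive : Irreflexiveᴵ I) (symmetric : Symmetricᴵ I) (A : PartialAction I m) where

  open PartialAction A
  open Trace I irreflexive symmetric

  -- The two axioms of a partial action are exactly what makes a swap of parallel letters harmless.
  actW-swap : ∀ {u v} → Swap I u v → ∀ s → actW A s u ≡ actW A s v
  actW-swap (swap p q c d Icd) = go p
    where
    go : ∀ p s → actW A s (p ++ c ∷ d ∷ q) ≡ actW A s (p ++ d ∷ c ∷ q)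
    go (x ∷ p) nothing  = refl
    go (x ∷ p) (just α) = go p (act α x)
    go []      nothing  = refl
    go []      (just α) with act α c in αc | act α d in αd
    ... | just α′ | just β′ with diamond α c d α′ β′ Icd (independent⇒≢ Icd) αc αd
    ...   | _ , α′d , β′c = trans (cong (λ t → actW A t q) α′d) (sym (cong (λ t → actW A t q) β′c))
    go [] (just α) | just α′ | nothing =
      cong (λ t → actW A t q) (persist α c d α′ Icd (independent⇒≢ Icd) αc αd)
    go [] (just α) | nothing | just β′ =
      sym (cong (λ t → actW A t q) (persist α d c β′ (independent-sym Icd) (independent⇒≢ (independent-sym Icd)) αd αc))
    go [] (just α) | nothing | nothing = refl

  actW-resp : ∀ s {u v} → u ∼ v → actW A s u ≡ actW A s v
  actW-resp s = EqClosure.gfold ≡-isEquivalence (λ w → actW A s w) (λ sw → actW-swap sw s)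

  actW-++ : ∀ s u v → actW A s (u ++ v) ≡ actW A (actW A s u) v
  actW-++ nothing  u       v = refl
  actW-++ (just α) []      v = refl
  actW-++ (just α) (c ∷ u) v = actW-++ (act α c) u v

  ∑-inM-++ : ∀ α γ y z (v : ℤ) →
             ∑ (allFin m) (λ β → if inM A α β y ∧ inM A β γ z then v else 0ℤ) ≡ (if inM A α γ (y ++ z) then v else 0ℤ)
  ∑-inM-++ α γ y z v = trans (through (actW A (just α) y))
    (cong (λ s → if ⌊ ≡-decᴹ _≟ᶠ_ s (just γ) ⌋ then v else 0ℤ) (sym (actW-++ (just α) y z)))
    where
    through : ∀ s → ∑ (allFin m) (λ β → if ⌊ ≡-decᴹ _≟ᶠ_ s (just β) ⌋ ∧ inM A β γ z then v else 0ℤ)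
                  ≡ (if ⌊ ≡-decᴹ _≟ᶠ_ (actW A s z) (just γ) ⌋ then v else 0ℤ)
    through nothing  = ∑-0 (allFin m)
    through (just b) = begin
      ∑ (allFin m) (λ β → if ⌊ ≡-decᴹ _≟ᶠ_ (just b) (just β) ⌋ ∧ inM A β γ z then v else 0ℤ)
        ≡⟨ ∑-cong (allFin m) (λ β → trans (cong (λ t → if t ∧ inM A β γ z then v else 0ℤ) (⌊⌋-map′ _ _ (b ≟ᶠ β)))
                                          (if-∧ ⌊ b ≟ᶠ β ⌋ (inM A β γ z))) ⟩
      ∑ (allFin m) (λ β → if ⌊ b ≟ᶠ β ⌋ then (if inM A β γ z then v else 0ℤ) else 0ℤ)
        ≡⟨ ∑-δ _≟ᶠ_ (allFin⁺ m) (∈-allFin b) (λ β → if inM A β γ z then v else 0ℤ) ⟩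
      (if inM A b γ z then v else 0ℤ) ∎

  module _ (_≟_ : Decidable (_∼[ I ]_)) where
    open Factorisations I irreflexive symmetric _≟_ using (∑-factorisations)

    product-factorises : ∀ (F G : Series n m) (c : Word → Word → ℤ) →
      (∀ {α β γ y z} → inM A α β y ≡ true → inM A β γ z ≡ true → F α β y * G β γ z ≡ c y z) →
      ∀ α γ x → product A _≟_ F G α γ x ≡ zeta A α γ x * ∑-factorisations (traceReps _≟_ (length x)) x c
    product-factorises F G c F*G≡c α γ x = begin
      product A _≟_ F G α γ x
        ≡⟨ ∑-cong (allFin m) (λ β → ∑-cong R (λ y → ∑-cong R (λ z → restrict β y z))) ⟩
      ∑ (allFin m) (λ β → ∑ R (λ y → ∑ R (λ z → term β y z)))
        ≡⟨ ∑-swap (allFin m) R (λ β y → ∑ R (term β y)) ⟩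
      ∑ R (λ y → ∑ (allFin m) (λ β → ∑ R (term β y)))
        ≡⟨ ∑-cong R (λ y → ∑-swap (allFin m) R (λ β → term β y)) ⟩
      ∑ R (λ y → ∑ R (λ z → ∑ (allFin m) (λ β → term β y z)))
        ≡⟨ ∑-cong R (λ y → ∑-cong R (λ z → sum-states y z)) ⟩
      ∑ R (λ y → ∑ R (λ z → zeta A α γ x * (if ⌊ (y ++ z) ≟ x ⌋ then c y z else 0ℤ)))
        ≡⟨ ∑-cong R (λ y → ∑-scale R (zeta A α γ x) (λ z → if ⌊ (y ++ z) ≟ x ⌋ then c y z else 0ℤ)) ⟩
      ∑ R (λ y → zeta A α γ x * ∑ R (λ z → if ⌊ (y ++ z) ≟ x ⌋ then c y z else 0ℤ))
        ≡⟨ ∑-scale R (zeta A α γ x) _ ⟩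
      zeta A α γ x * ∑-factorisations R x c ∎
      where
      R : List Word
      R = traceReps _≟_ (length x)
      term : Fin m → Word → Word → ℤ
      term β y z = if ⌊ (y ++ z) ≟ x ⌋ then (if inM A α β y ∧ inM A β γ z then c y z else 0ℤ) else 0ℤ
      restrict : ∀ β y z → (if ⌊ (y ++ z) ≟ x ⌋ ∧ inM A α β y ∧ inM A β γ z then F α β y * G β γ z else 0ℤ)
                         ≡ term β y z
      restrict β y z = go ⌊ (y ++ z) ≟ x ⌋ (inM A α β y) (inM A β γ z) refl refl
        where
        go : ∀ d p q → inM A α β y ≡ p → inM A β γ z ≡ q →
             (if d ∧ p ∧ q then F α β y * G β γ z else 0ℤ) ≡ (if d then (if p ∧ q then c y z else 0ℤ) else 0ℤ)
        go false p     q     _  _  = refl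
        go true  false q     _  _  = refl
        go true  true  false _  _  = refl
        go true  true  true  αy βz = F*G≡c αy βz
      sum-states : ∀ y z → ∑ (allFin m) (λ β → term β y z) ≡ zeta A α γ x * (if ⌊ (y ++ z) ≟ x ⌋ then c y z else 0ℤ)
      sum-states y z = trans (∑-if (allFin m) ⌊ (y ++ z) ≟ x ⌋ _) (through-x ((y ++ z) ≟ x))
        where
        through-x : (d : Dec (y ++ z ∼ x)) →
                    (if ⌊ d ⌋ then ∑ (allFin m) (λ β → if inM A α β y ∧ inM A β γ z then c y z else 0ℤ) else 0ℤ)
                    ≡ zeta A α γ x * (if ⌊ d ⌋ then c y z else 0ℤ)
        through-x (yes yz∼x) = begin
          ∑ (allFin m) (λ β → if inM A α β y ∧ inM A β γ z then c y z else 0ℤ) ≡⟨ ∑-inM-++ α γ y z (c y z) ⟩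
          (if inM A α γ (y ++ z) then c y z else 0ℤ)
            ≡⟨ cong (λ s → if ⌊ ≡-decᴹ _≟ᶠ_ s (just γ) ⌋ then c y z else 0ℤ) (actW-resp (just α) yz∼x) ⟩
          (if inM A α γ x then c y z else 0ℤ) ≡⟨ if-* (inM A α γ x) (c y z) ⟩
          zeta A α γ x * c y z ∎
        through-x (no _) = sym (ℤ.*-zeroʳ (zeta A α γ x))

module Inversion {n m : ℕ} {I : Fin n → Fin n → Bool}
                 (irreflexive : Irreflexiveᴵ I) (symmetric : Symmetricᴵ I)
                 (A : PartialAction I m) (_≟_ : Decidable (_∼[ I ]_)) where

  open Trace I irreflexive symmetric
  open Factorisations I irreflexive symmetric _≟_
  open Action irreflexive symmetric A

  product≋identity : ∀ (F G : Series n m) (c : Word → Word → ℤ) →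
    (∀ {α β γ y z} → inM A α β y ≡ true → inM A β γ z ≡ true → F α β y * G β γ z ≡ c y z) →
    c [] [] ≡ 1ℤ → (∀ {x} → x ≢ [] → ∑-factorisations (traceReps _≟_ (length x)) x c ≡ 0ℤ) →
    product A _≟_ F G ≋ identity
  product≋identity F G c F*G≡c c[]≡1 vanish α γ x = trans (product-factorises _≟_ F G c F*G≡c α γ x) (at x)
    where
    -- traceReps _≟_ 0 computes to [] ∷ [], so the sum has the single term c [] [].
    single-factorisation : ∑-factorisations (traceReps _≟_ 0) [] c ≡ 1ℤ
    single-factorisation =
      trans (ℤ.+-identityʳ _) (trans (ℤ.+-identityʳ _) (trans (if-yes ([] ≟ []) ∼-refl) c[]≡1))
    at : ∀ x → zeta A α γ x * ∑-factorisations (traceReps _≟_ (length x)) x c ≡ identity {n} α γ x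
    at []      = begin
      zeta A α γ [] * ∑-factorisations (traceReps _≟_ 0) [] c ≡⟨ cong (zeta A α γ [] *_) single-factorisation ⟩
      zeta A α γ [] * 1ℤ ≡⟨ ℤ.*-identityʳ _ ⟩
      zeta A α γ []      ≡⟨ cong (λ b → if b then 1ℤ else 0ℤ) (⌊⌋-map′ _ _ (α ≟ᶠ γ)) ⟩
      identity {n} α γ [] ∎
    at (a ∷ x) = trans (cong (zeta A α γ (a ∷ x) *_) (vanish {a ∷ x} λ ())) (ℤ.*-zeroʳ (zeta A α γ (a ∷ x)))

  mobius-zeta : ∀ {α β γ y z} → inM A α β y ≡ true → inM A β γ z ≡ true → mobius I A α β y * zeta A β γ z ≡ μ y
  mobius-zeta {α} {β} {γ} {y} {z} αy βz = begin
    (if ⌊ isClique? I y ⌋ ∧ inM A α β y then -1ℤ ^ length y else 0ℤ) * (if inM A β γ z then 1ℤ else 0ℤ)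
      ≡⟨ cong₂ (λ p q → (if ⌊ isClique? I y ⌋ ∧ p then -1ℤ ^ length y else 0ℤ) * (if q then 1ℤ else 0ℤ)) αy βz ⟩
    (if ⌊ isClique? I y ⌋ ∧ true then -1ℤ ^ length y else 0ℤ) * 1ℤ
      ≡⟨ ℤ.*-identityʳ _ ⟩
    (if ⌊ isClique? I y ⌋ ∧ true then -1ℤ ^ length y else 0ℤ)
      ≡⟨ cong (λ b → if b then -1ℤ ^ length y else 0ℤ) (∧-identityʳ _) ⟩
    μ y ∎

  zeta-mobius : ∀ {α β γ y z} → inM A α β y ≡ true → inM A β γ z ≡ true → zeta A α β y * mobius I A β γ z ≡ μ z
  zeta-mobius {α} {β} {γ} {y} {z} αy βz = begin
    (if inM A α β y then 1ℤ else 0ℤ) * (if ⌊ isClique? I z ⌋ ∧ inM A β γ z then -1ℤ ^ length z else 0ℤ)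
      ≡⟨ cong₂ (λ p q → (if p then 1ℤ else 0ℤ) * (if ⌊ isClique? I z ⌋ ∧ q then -1ℤ ^ length z else 0ℤ)) αy βz ⟩
    1ℤ * (if ⌊ isClique? I z ⌋ ∧ true then -1ℤ ^ length z else 0ℤ)
      ≡⟨ ℤ.*-identityˡ _ ⟩
    (if ⌊ isClique? I z ⌋ ∧ true then -1ℤ ^ length z else 0ℤ)
      ≡⟨ cong (λ b → if b then -1ℤ ^ length z else 0ℤ) (∧-identityʳ _) ⟩
    μ z ∎

-- The argument does not use |Σ| ≥ 2.
theorem3 : (n : ℕ) → 2 ≤ n → (I : Fin n → Fin n → Bool) →
           Irreflexiveᴵ I → Symmetricᴵ I →
           (m : ℕ) → (A : PartialAction I m) →
           (dec : Decidable (_∼[ I ]_)) →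
           (product A dec (mobius I A) (zeta A) ≋ identity)
           × (product A dec (zeta A) (mobius I A) ≋ identity)
theorem3 n _ I irreflexive symmetric m A _≟_ =
    product≋identity (mobius I A) (zeta A) (λ y _ → μ y) (λ {α β γ y z} → mobius-zeta {α} {β} {γ} {y} {z}) refl
      (λ {x} → ∑-factorisations-μ-prefix (traceReps-representatives (length x)) {x} ≤-refl)
  , product≋identity (zeta A) (mobius I A) (λ _ z → μ z) (λ {α β γ y z} → zeta-mobius {α} {β} {γ} {y} {z}) refl
      (λ {x} → ∑-factorisations-μ-suffix (traceReps-representatives (length x)) {x} ≤-refl)
  where
  open Factorisations I irreflexive symmetric _≟_
  open Inversion irreflexive symmetric A _≟_
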